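{- Let $X$ be a finite set and $\alpha\in S_X$. The number of partitions $\pi$ of $X$ such that the system $(X,\pi,\alpha)$ has $D=\emptyset$ (always increasing entropy) equals $$\sum_{l\in\underline{\mathrm{Cyc}(\alpha)}}\ \prod_{k\in\mathrm{Im}(l)}\frac{\overline{l}(k)!}{k!^{\overline{l}(k)/k}\,\left(\overline{l}(k)/k\right)!}.$$
   Context: $\mathrm{Cyc}(\alpha)$ is the partition of $X$ into the cycles (orbits) of $\alpha$. For a family $S$ of subsets of $X$, $\underline{S}$ denotes the set of maps $l:S\to\mathbb{N}_{\ge1}$ such that for every $k\in\mathbb{N}_{\ge1}$, $k$ divides $\overline{l}(k)=\sum_{B\in S,\ l(B)=k}|B|$. For a partition $\pi$, $S(i)=\ln$ of the size of the block of $\pi$ containing $i$, and $D=\{i\in X:S(\alpha(i))<S(i)\}$. -}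

module Defs where

open import Data.Nat using (ℕ; zero; suc; _+_; _*_; _^_; _/_; _<_; _≥_; _!)
open import Data.Nat.Properties using (_≟_; m^n≢0; m*n≢0; _!≢0)

open import Data.Nat.Divisibility using (_∣_)
open import Data.Fin using (Fin)
open import Data.Fin.Subset using (Subset; _∈_; ∣_∣)
open import Data.Fin.Permutation using (Permutation′; _⟨$⟩ʳ_)
open import Data.Vec using (Vec; lookup)
open import Data.List using (List; map; deduplicate; allFin; filter; length)
open import Data.Nat.ListAction using (product; sum)
open import Data.List.Relation.Unary.Unique.Propositional using (Unique)
open import Data.List.Membership.Propositional renaming (_∈_ to _∈L_)
open import Data.Product using (∃; _×_)
open import Relation.Binary.PropositionalEquality using (_≡_)
open import Relation.Nullary using (¬_)

-- The underlying finite set X is Fin n.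

-- A partition π of Fin n, given by the map i ↦ (block of π containing i).
-- Conditions: i lies in its own block, and if j lies in the block of i,
-- then the block of j is the block of i.  (This determines π uniquely and
-- every partition arises from exactly one such map.)
IsPartition : {n : ℕ} → Vec (Subset n) n → Set
IsPartition {n} B =
  ((i : Fin n) → i ∈ lookup B i) ×
  ((i j : Fin n) → j ∈ lookup B i → lookup B j ≡ lookup B i)

-- Size of the block of π containing i;  S(i) = ln (blockSize B i).
blockSize : {n : ℕ} → Vec (Subset n) n → Fin n → ℕ
blockSize B i = ∣ lookup B i ∣

-- i ∈ D  iff  S(α i) < S(i), equivalently (ln strictly increasing)
-- |block(α i)| < |block(i)|.
InD : {n : ℕ} → Permutation′ n → Vec (Subset n) n → Fin n → Set
InD α B i = blockSize B (α ⟨$⟩ʳ i) < blockSize B i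

DEmpty : {n : ℕ} → Permutation′ n → Vec (Subset n) n → Set
DEmpty {n} α B = (i : Fin n) → ¬ InD α B i

iter : {n : ℕ} → Permutation′ n → ℕ → Fin n → Fin n
iter α zero i = i
iter α (suc m) i = α ⟨$⟩ʳ (iter α m i)

SameCycle : {n : ℕ} → Permutation′ n → Fin n → Fin n → Set
SameCycle α i j = ∃ λ m → iter α m i ≡ j

-- A map l : Cyc(α) → ℕ is represented by the function on points
-- i ↦ l(cycle of i), i.e. a vector constant on cycles of α.
IsCycleMap : {n : ℕ} → Permutation′ n → Vec ℕ n → Set
IsCycleMap {n} α l = (i j : Fin n) → SameCycle α i j → lookup l i ≡ lookup l j

-- l̄(k) = Σ_{B ∈ Cyc α, l(B) = k} |B| = number of points whose cycle has l-value k
lbar : {n : ℕ} → Vec ℕ n → ℕ → ℕ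
lbar {n} l k = length (filter (λ i → lookup l i ≟ k) (allFin n))

InUnderline : {n : ℕ} → Permutation′ n → Vec ℕ n → Set
InUnderline {n} α l =
  IsCycleMap α l ×
  ((i : Fin n) → lookup l i ≥ 1) ×
  ((k : ℕ) → k ≥ 1 → k ∣ lbar l k)

-- The factor  L! / (k!^(L/k) (L/k)!)  (for k ≥ 1; k = 0 never occurs
-- since k ranges over Im(l) ⊆ ℕ≥1).
factor : ℕ → ℕ → ℕ
factor zero L = 1
factor (suc k) L =
  (L ! / (((suc k !) ^ m) * (m !)))
    {{m*n≢0 ((suc k !) ^ m) (m !) {{m^n≢0 (suc k !) m {{(suc k) !≢0}}}} {{m !≢0}}}}
  where
  m : ℕ
  m = L / suc k

image : {n : ℕ} → Vec ℕ n → List ℕ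
image {n} l = deduplicate _≟_ (map (lookup l) (allFin n))

term : {n : ℕ} → Vec ℕ n → ℕ
term l = product (map (λ k → factor k (lbar l k)) (image l))

Enumerates : {A : Set} → (A → Set) → List A → Set
Enumerates P xs = Unique xs × (∀ x → x ∈L xs → P x) × (∀ x → P x → x ∈L xs)

module Submission where

-- Write s(i) = |block of i|.  Since α permutes X, Σ s(α i) = Σ s(i); so D = ∅, i.e.
-- s(i) ≤ s(α i) for all i, forces s ∘ α = s, and s is constant on the cycles of α.
-- Conversely, block sizes constant on cycles give D = ∅.  Hence the partitions with D = ∅
-- are the partitions whose size vector l = s is constant on cycles, grouped by l.
--
-- The partitions with a given size vector l are counted via partial partitions: partitions of
-- a subset U ⊆ X with block sizes l.  If l ≥ 1 on U and k ∣ #{i ∈ U : l i = k} =: c_U(k),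
-- their number is ∏_k factor k (c_U(k)).  Induction on |U|: fix u ∈ U with l u = K; the block
-- of u is one of C(c_U(K) - 1, K - 1) subsets, and removing it leaves a partial partition of
-- the rest, while factor K (K(q+1)) = C(Kq + K - 1, K - 1) · factor K (Kq).  The same removal
-- shows that the divisibility is necessary, so the occurring size vectors are exactly the
-- elements of underline(Cyc α).

open import Defs
open import Data.Nat using (ℕ; zero; suc; _+_; _*_; _∸_; _^_; _/_; _!; _≤_; _<_; _<?_; s≤s; z≤n; NonZero; >-nonZero; >-nonZero⁻¹)
open import Data.Nat.Properties
open import Data.Nat.Divisibility using (_∣_; divides; divides-refl; _∣0; ∣-refl; ∣m∣n⇒∣m+n; ∣m+n∣m⇒∣n)
open import Data.Nat.Combinatorics using (_C_; nCk≡n!/k![n-k]!; k![n∸k]!∣n!; nCk+nC[k+1]≡[n+1]C[k+1])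
open import Data.Nat.DivMod using (m*n/n≡m; m/n*n≡m; /-congʳ)
open import Data.Nat.ListAction using (sum; product)
open import Data.Nat.ListAction.Properties using (product≢0)
open import Data.Nat.Tactic.RingSolver using (solve-∀)
open import Data.Bool using (Bool; true; false; if_then_else_; _∧_; _∨_; not)
import Data.Bool.Properties
open import Data.Bool.Properties using () renaming (_≟_ to _≟ᵇ_)
import Data.Empty
open import Data.Empty using (⊥-elim)
open import Data.Fin using (Fin; zero; suc)
open import Data.Fin.Properties using (all?; any?)
open import Data.Fin.Permutation using (Permutation′; _⟨$⟩ʳ_)
open import Data.Fin.Subset using (Subset; ∣_∣; ⊥; ⊤; _─_; _∩_; ⁅_⁆)
open import Data.Fin.Subset.Properties using (_∈?_; ∣p∣≤n; ∩-zeroˡ; ∩-identityˡ; ∣⊥∣≡0; ∣⁅x⁆∣≡1; x∈⁅x⁆; x∈⁅y⁆⇒x≡y)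
open import Data.Vec as Vec using (Vec; []; _∷_; lookup; tabulate)
import Data.Vec.Properties
open import Data.Vec.Properties using ([]=⇒lookup; lookup⇒[]=; ∷-injective; lookup-zipWith; lookup-replicate; tabulate∘lookup; tabulate-cong; lookup∘tabulate)
import Data.List
open import Data.List using (List; []; _∷_; length; map; filter; _++_; cartesianProductWith; allFin; deduplicate)
open import Data.List.Properties using (length-map; length-++; filter-++; filter-≐; filter-none; map-cong-local; ++-identityʳ)
open import Data.List.Membership.Propositional using (_∈_; _∉_)
open import Data.List.Membership.Propositional.Properties
  using (∈-filter⁻; ∈-filter⁺; ∈-map⁺; ∈-map⁻; ∈-cartesianProductWith⁺; ∈-deduplicate⁺; ∈-deduplicate⁻; ∈-allFin)
open import Data.List.Membership.Propositional.Properties.WithK using (unique∧set⇒bag)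
open import Data.List.Relation.Binary.BagAndSetEquality using (∼bag⇒↭)
open import Data.List.Relation.Binary.Permutation.Propositional.Properties using (↭-length)
open import Data.List.Relation.Unary.Unique.Propositional using (Unique; []; _∷_)
open import Data.List.Relation.Unary.Unique.Propositional.Properties
  using (Unique[x∷xs]⇒x∉xs; cartesianProductWith⁺; filter⁺)
open import Data.List.Relation.Unary.Unique.DecPropositional.Properties _≟_ using (deduplicate-!)
import Data.List.Relation.Unary.All as All
import Data.List.Relation.Unary.All.Properties as AllProperties
open import Data.List.Relation.Unary.Any using (here; there)
open import Data.Product using (∃; ∃₂; _×_; _,_; proj₁; proj₂)
open import Function using (_∘_)
open import Function.Bundles using (mk⇔)
open import Relation.Nullary using (Dec; yes; no; does; ¬_; ¬?; _×-dec_; _→-dec_)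
open import Relation.Nullary.Decidable using (map′; dec-true; dec-false)
open import Relation.Unary using (Pred; Decidable)
open import Relation.Binary using (DecidableEquality)
open import Relation.Binary.PropositionalEquality
open import Level using (0ℓ)

∧-true : ∀ {a b} → a ∧ b ≡ true → a ≡ true × b ≡ true
∧-true {true} {true} refl = refl , refl

module ListCounting where

  length-≡-of-same-members : {A : Set} {xs ys : List A} → Unique xs → Unique ys →
    (∀ x → x ∈ xs → x ∈ ys) → (∀ x → x ∈ ys → x ∈ xs) → length xs ≡ length ys
  length-≡-of-same-members ux uy xs⊆ys ys⊆xs =
    ↭-length (∼bag⇒↭ (unique∧set⇒bag ux uy (mk⇔ (xs⊆ys _) (ys⊆xs _))))

  map-unique : {A B : Set} (f : A → B) (g : B → A) (xs : List A) →
    (∀ x → x ∈ xs → g (f x) ≡ x) → Unique xs → Unique (map f xs)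
  map-unique f g [] _ [] = []
  map-unique f g (x ∷ xs) gf (x∉xs ∷ uxs) =
    distinct xs x∉xs (λ y → gf y ∘ there) ∷ map-unique f g xs (λ y → gf y ∘ there) uxs
    where
    distinct : ∀ ys → All.All (λ y → ¬ x ≡ y) ys → (∀ y → y ∈ ys → g (f y) ≡ y) →
      All.All (λ z → ¬ f x ≡ z) (map f ys)
    distinct [] All.[] _ = All.[]
    distinct (y ∷ ys) (x≢y All.∷ rest) gfys =
      (λ fx≡fy → x≢y (trans (sym (gf x (here refl))) (trans (cong g fx≡fy) (gfys y (here refl)))))
      All.∷ distinct ys rest (λ z → gfys z ∘ there)

  length-≡-of-bijection : {A B : Set} (xs : List A) (ys : List B) → Unique xs → Unique ys →
    (f : A → B) (g : B → A) →
    (∀ x → x ∈ xs → f x ∈ ys) → (∀ y → y ∈ ys → g y ∈ xs) →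
    (∀ x → x ∈ xs → g (f x) ≡ x) → (∀ y → y ∈ ys → f (g y) ≡ y) →
    length xs ≡ length ys
  length-≡-of-bijection xs ys ux uy f g f∈ g∈ gf fg =
    trans (sym (length-map f xs))
      (length-≡-of-same-members (map-unique f g xs gf ux) uy image⊆ys ys⊆image)
    where
    image⊆ys : ∀ y → y ∈ map f xs → y ∈ ys
    image⊆ys y y∈ with ∈-map⁻ f y∈
    ... | x , x∈ , refl = f∈ x x∈
    ys⊆image : ∀ y → y ∈ ys → y ∈ map f xs
    ys⊆image y y∈ = subst (_∈ map f xs) (fg y y∈) (∈-map⁺ f (g∈ y y∈))

  filter-nonempty : {A : Set} {P : Pred A 0ℓ} (P? : Decidable P) (xs : List A) →
    1 ≤ length (filter P? xs) → ∃ λ x → x ∈ xs × P x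
  filter-nonempty P? xs 1≤len with filter P? xs in eq
  ... | y ∷ _ = y , ∈-filter⁻ P? {xs = xs} (subst (y ∈_) (sym eq) (here refl))

  length-filter-≐ : {A : Set} {P Q : Pred A 0ℓ} (P? : Decidable P) (Q? : Decidable Q) (xs : List A) →
    (∀ {x} → P x → Q x) → (∀ {x} → Q x → P x) → length (filter P? xs) ≡ length (filter Q? xs)
  length-filter-≐ P? Q? xs P⇒Q Q⇒P = cong length (filter-≐ P? Q? (P⇒Q , Q⇒P) xs)

  length-filter-∅ : {A : Set} {P : Pred A 0ℓ} (P? : Decidable P) (xs : List A) →
    (∀ x → ¬ P x) → length (filter P? xs) ≡ 0
  length-filter-∅ P? xs ¬P = cong length (filter-none P? {xs = xs} (All.tabulate (λ {x} _ → ¬P x)))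

  length-filter-map : {A B : Set} {P : Pred B 0ℓ} (P? : Decidable P) (f : A → B) (xs : List A) →
    length (filter P? (map f xs)) ≡ length (filter (P? ∘ f) xs)
  length-filter-map P? f [] = refl
  length-filter-map P? f (x ∷ xs) with does (P? (f x))
  ... | true = cong suc (length-filter-map P? f xs)
  ... | false = length-filter-map P? f xs

  sum-cong : {A : Set} (g h : A → ℕ) (ks : List A) → (∀ k → k ∈ ks → g k ≡ h k) →
    sum (map g ks) ≡ sum (map h ks)
  sum-cong g h ks g≡h = cong sum (map-cong-local (All.tabulate (g≡h _)))

  product-cong : {A : Set} (g h : A → ℕ) (ks : List A) → (∀ k → k ∈ ks → g k ≡ h k) →
    product (map g ks) ≡ product (map h ks)
  product-cong g h ks g≡h = cong product (map-cong-local (All.tabulate (g≡h _)))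

  sum-const : {A : Set} (c : ℕ) (ks : List A) → sum (map (λ _ → c) ks) ≡ length ks * c
  sum-const c [] = refl
  sum-const c (k ∷ ks) = cong (c +_) (sum-const c ks)

  module _ {K : Set} (_≟_ : DecidableEquality K) where

    fibre : {A : Set} (f : A → K) → List A → K → List A
    fibre f xs k = filter (λ x → f x ≟ k) xs

    private
      indicator : K → K → ℕ
      indicator y k = if does (y ≟ k) then 1 else 0

      sum-indicator-∉ : ∀ y ks → y ∉ ks → sum (map (indicator y) ks) ≡ 0
      sum-indicator-∉ y [] _ = refl
      sum-indicator-∉ y (k ∷ ks) y∉ with y ≟ k
      ... | yes refl = ⊥-elim (y∉ (here refl))
      ... | no _ = sum-indicator-∉ y ks (y∉ ∘ there)

      sum-indicator-∈ : ∀ y ks → Unique ks → y ∈ ks → sum (map (indicator y) ks) ≡ 1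
      sum-indicator-∈ y (k ∷ ks) (u ∷ us) y∈ with y ≟ k | y∈
      ... | yes refl | _ = cong suc (sum-indicator-∉ y ks (Unique[x∷xs]⇒x∉xs (u ∷ us)))
      ... | no y≢k | here y≡k = ⊥-elim (y≢k y≡k)
      ... | no _ | there y∈ks = sum-indicator-∈ y ks us y∈ks

      sum-+ : (g h : K → ℕ) (ks : List K) →
        sum (map (λ k → g k + h k) ks) ≡ sum (map g ks) + sum (map h ks)
      sum-+ g h [] = refl
      sum-+ g h (k ∷ ks) rewrite sum-+ g h ks = interchange (g k) (h k) (sum (map g ks)) (sum (map h ks))
        where
        interchange : ∀ a b c d → a + b + (c + d) ≡ a + c + (b + d)
        interchange = solve-∀

    length-by-fibres : {A : Set} (f : A → K) (xs : List A) (ks : List K) → Unique ks →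
      (∀ x → x ∈ xs → f x ∈ ks) →
      length xs ≡ sum (map (λ k → length (fibre f xs k)) ks)
    length-by-fibres f [] ks _ _ = trans (sym (*-zeroʳ (length ks))) (sym (sum-const 0 ks))
    length-by-fibres f (x ∷ xs) ks uks f∈ = begin
        suc (length xs)
      ≡⟨ cong₂ _+_ (sym (sum-indicator-∈ (f x) ks uks (f∈ x (here refl))))
                   (length-by-fibres f xs ks uks (λ y → f∈ y ∘ there)) ⟩
        sum (map (indicator (f x)) ks) + sum (map (λ k → length (fibre f xs k)) ks)
      ≡⟨ sym (sum-+ (indicator (f x)) _ ks) ⟩
        sum (map (λ k → indicator (f x) k + length (fibre f xs k)) ks)
      ≡⟨ sum-cong _ _ ks (λ k _ → fibre-step k) ⟩
        sum (map (λ k → length (fibre f (x ∷ xs) k)) ks)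
      ∎
      where
      open ≡-Reasoning
      fibre-step : ∀ k → indicator (f x) k + length (fibre f xs k) ≡ length (fibre f (x ∷ xs) k)
      fibre-step k with does (f x ≟ k)
      ... | true = refl
      ... | false = refl

    product-update : (g h : K → ℕ) (c : ℕ) (k : K) (ks : List K) → Unique ks → k ∈ ks →
      g k ≡ c * h k → (∀ j → ¬ j ≡ k → g j ≡ h j) →
      product (map g ks) ≡ c * product (map h ks)
    product-update g h c k (j ∷ ks) (u ∷ us) k∈ gk≡chk gj≡hj with j ≟ k | k∈
    ... | yes refl | _ = begin
          g j * product (map g ks)
        ≡⟨ cong₂ _*_ gk≡chk (product-cong g h ks (λ i i∈ → gj≡hj i (λ { refl → j∉ks i∈ }))) ⟩
          c * h j * product (map h ks)
        ≡⟨ *-assoc c (h j) _ ⟩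
          c * (h j * product (map h ks)) ∎
      where
      open ≡-Reasoning
      j∉ks = Unique[x∷xs]⇒x∉xs (u ∷ us)
    ... | no j≢k | here k≡j = ⊥-elim (j≢k (sym k≡j))
    ... | no j≢k | there k∈ks = begin
          g j * product (map g ks)
        ≡⟨ cong₂ _*_ (gj≡hj j j≢k) (product-update g h c k ks us k∈ks gk≡chk gj≡hj) ⟩
          h j * (c * product (map h ks))
        ≡⟨ x*[c*y]≡c*[x*y] (h j) c _ ⟩
          c * (h j * product (map h ks)) ∎
      where
      open ≡-Reasoning
      x*[c*y]≡c*[x*y] : ∀ x c y → x * (c * y) ≡ c * (x * y)
      x*[c*y]≡c*[x*y] = solve-∀

module Enumeration where

  vectors : {A : Set} → List A → (n : ℕ) → List (Vec A n)
  vectors xs zero = [] ∷ []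
  vectors xs (suc n) = cartesianProductWith _∷_ xs (vectors xs n)

  ∈-vectors : {A : Set} (xs : List A) → (∀ x → x ∈ xs) → ∀ n (v : Vec A n) → v ∈ vectors xs n
  ∈-vectors xs all∈ zero [] = here refl
  ∈-vectors xs all∈ (suc n) (x ∷ v) = ∈-cartesianProductWith⁺ _∷_ (all∈ x) (∈-vectors xs all∈ n v)

  vectors-unique : {A : Set} (xs : List A) → Unique xs → ∀ n → Unique (vectors xs n)
  vectors-unique xs uxs zero = All.[] ∷ []
  vectors-unique xs uxs (suc n) = cartesianProductWith⁺ _∷_ ∷-injective uxs (vectors-unique xs uxs n)

  subsets : (n : ℕ) → List (Subset n)
  subsets = vectors (false ∷ true ∷ [])

  ∈-subsets : ∀ {n} (S : Subset n) → S ∈ subsets n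
  ∈-subsets {n} = ∈-vectors _ (λ { false → here refl ; true → there (here refl) }) n

  subsets-unique : ∀ n → Unique (subsets n)
  subsets-unique = vectors-unique _ (((λ ()) All.∷ All.[]) ∷ All.[] ∷ [])

  allBlocks : ∀ n → List (Vec (Subset n) n)
  allBlocks n = vectors (subsets n) n

  ∈-allBlocks : ∀ {n} (B : Vec (Subset n) n) → B ∈ allBlocks n
  ∈-allBlocks {n} = ∈-vectors (subsets n) ∈-subsets n

  allBlocks-unique : ∀ n → Unique (allBlocks n)
  allBlocks-unique n = vectors-unique (subsets n) (subsets-unique n) n

module SubsetCounting where
  open Enumeration
  open ListCounting using (length-filter-map; length-filter-≐; length-filter-∅)

  _⊆ᵇ_ : ∀ {n} → Subset n → Subset n → Bool
  [] ⊆ᵇ [] = true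
  (a ∷ A) ⊆ᵇ (s ∷ S) = (not a ∨ s) ∧ (A ⊆ᵇ S)

  gap : ∀ {n} → Subset n → Subset n → ℕ
  gap [] [] = 0
  gap (a ∷ A) (v ∷ V) = (if v ∧ not a then 1 else 0) + gap A V

  Between : ∀ {n} → Subset n → Subset n → ℕ → Subset n → Set
  Between A V m S = A ⊆ᵇ S ≡ true × S ⊆ᵇ V ≡ true × ∣ S ∣ ≡ ∣ A ∣ + m

  Between? : ∀ {n} (A V : Subset n) m → Decidable (Between A V m)
  Between? A V m S = (A ⊆ᵇ S ≟ᵇ true) ×-dec ((S ⊆ᵇ V ≟ᵇ true) ×-dec (∣ S ∣ ≟ ∣ A ∣ + m))

  ⊆ᵇ⇒∣∣≤ : ∀ {n} (A S : Subset n) → A ⊆ᵇ S ≡ true → ∣ A ∣ ≤ ∣ S ∣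
  ⊆ᵇ⇒∣∣≤ [] [] _ = z≤n
  ⊆ᵇ⇒∣∣≤ (false ∷ A) (false ∷ S) A⊆S = ⊆ᵇ⇒∣∣≤ A S A⊆S
  ⊆ᵇ⇒∣∣≤ (false ∷ A) (true ∷ S) A⊆S = m≤n⇒m≤1+n (⊆ᵇ⇒∣∣≤ A S A⊆S)
  ⊆ᵇ⇒∣∣≤ (true ∷ A) (true ∷ S) A⊆S = s≤s (⊆ᵇ⇒∣∣≤ A S A⊆S)

  ⊆ᵇ⇒⊆ : ∀ {n} (A S : Subset n) → A ⊆ᵇ S ≡ true → ∀ i → lookup A i ≡ true → lookup S i ≡ true
  ⊆ᵇ⇒⊆ (true ∷ A) (true ∷ S) _ zero _ = refl
  ⊆ᵇ⇒⊆ (a ∷ A) (s ∷ S) A⊆S (suc i) i∈A = ⊆ᵇ⇒⊆ A S (proj₂ (∧-true {not a ∨ s} A⊆S)) i i∈A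

  ⊆⇒⊆ᵇ : ∀ {n} (A S : Subset n) → (∀ i → lookup A i ≡ true → lookup S i ≡ true) → A ⊆ᵇ S ≡ true
  ⊆⇒⊆ᵇ [] [] _ = refl
  ⊆⇒⊆ᵇ (false ∷ A) (s ∷ S) A⊆S = trans (Data.Bool.Properties.∧-identityˡ _) (⊆⇒⊆ᵇ A S (A⊆S ∘ suc))
  ⊆⇒⊆ᵇ (true ∷ A) (s ∷ S) A⊆S with s | A⊆S zero refl
  ... | true | _ = ⊆⇒⊆ᵇ A S (A⊆S ∘ suc)

  ∣∣+gap : ∀ {n} (A V : Subset n) → A ⊆ᵇ V ≡ true → ∣ A ∣ + gap A V ≡ ∣ V ∣
  ∣∣+gap [] [] _ = refl
  ∣∣+gap (false ∷ A) (false ∷ V) A⊆V = ∣∣+gap A V A⊆V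
  ∣∣+gap (false ∷ A) (true ∷ V) A⊆V = trans (+-suc _ _) (cong suc (∣∣+gap A V A⊆V))
  ∣∣+gap (true ∷ A) (true ∷ V) A⊆V = cong suc (∣∣+gap A V A⊆V)

  count-subsets-suc : ∀ {n} {P : Pred (Subset (suc n)) 0ℓ} (P? : Decidable P) →
    length (filter P? (subsets (suc n))) ≡
      length (filter (P? ∘ (false ∷_)) (subsets n)) + length (filter (P? ∘ (true ∷_)) (subsets n))
  count-subsets-suc {n} P? = begin
      length (filter P? (map (false ∷_) L ++ map (true ∷_) L ++ []))
    ≡⟨ cong length (filter-++ P? (map (false ∷_) L) _) ⟩
      length (filter P? (map (false ∷_) L) ++ filter P? (map (true ∷_) L ++ []))
    ≡⟨ length-++ (filter P? (map (false ∷_) L)) ⟩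
      length (filter P? (map (false ∷_) L)) + length (filter P? (map (true ∷_) L ++ []))
    ≡⟨ cong₂ _+_ (length-filter-map P? (false ∷_) L)
                 (cong (length ∘ filter P?) (++-identityʳ (map (true ∷_) L))) ⟩
      length (filter (P? ∘ (false ∷_)) L) + length (filter P? (map (true ∷_) L))
    ≡⟨ cong (length (filter (P? ∘ (false ∷_)) L) +_) (length-filter-map P? (true ∷_) L) ⟩
      length (filter (P? ∘ (false ∷_)) L) + length (filter (P? ∘ (true ∷_)) L) ∎
    where
    open ≡-Reasoning
    L = subsets n

  -- Induction on n, splitting on the first coordinate; Pascal's rule closes the step.
  count-between : ∀ n (A V : Subset n) m → A ⊆ᵇ V ≡ true →
    length (filter (Between? A V m) (subsets n)) ≡ gap A V C m
  count-between zero [] [] zero _ = refl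
  count-between zero [] [] (suc m) _ = refl
  count-between (suc n) (a ∷ A) (v ∷ V) m A⊆V =
    trans (count-subsets-suc (Between? (a ∷ A) (v ∷ V) m)) (by-head a v m A⊆V)
    where
    count : (a v s : Bool) → ℕ → ℕ
    count a v s m = length (filter (λ S → Between? (a ∷ A) (v ∷ V) m (s ∷ S)) (subsets n))

    reduces : ∀ a v s m m′ → A ⊆ᵇ V ≡ true →
      (∀ {S} → Between (a ∷ A) (v ∷ V) m (s ∷ S) → Between A V m′ S) →
      (∀ {S} → Between A V m′ S → Between (a ∷ A) (v ∷ V) m (s ∷ S)) →
      count a v s m ≡ gap A V C m′
    reduces _ _ _ _ m′ A⊆V′ to from =
      trans (length-filter-≐ _ (Between? A V m′) (subsets n) to from) (count-between n A V m′ A⊆V′)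

    impossible : ∀ a v s m → (∀ {S} → ¬ Between (a ∷ A) (v ∷ V) m (s ∷ S)) → count a v s m ≡ 0
    impossible _ _ _ _ ¬between = length-filter-∅ _ (subsets n) (λ _ → ¬between)

    by-head : ∀ a v m → (not a ∨ v) ∧ (A ⊆ᵇ V) ≡ true →
      count a v false m + count a v true m ≡ gap (a ∷ A) (v ∷ V) C m
    by-head false false m A⊆V′ =
      trans (cong₂ _+_ (reduces false false false m m A⊆V′ (λ b → b) (λ b → b))
                       (impossible false false true m (λ { (_ , () , _) })))
            (+-identityʳ _)
    by-head false true zero A⊆V′ =
      trans (cong₂ _+_ (reduces false true false 0 0 A⊆V′ (λ b → b) (λ b → b))
                       (impossible false true true 0 too-large))
            (+-identityʳ _)
      where
      too-large : ∀ {S} → ¬ Between (false ∷ A) (true ∷ V) 0 (true ∷ S)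
      too-large {S} (A⊆S , _ , |S|+1≡|A|+0) =
        1+n≰n (≤-trans (≤-reflexive (trans |S|+1≡|A|+0 (+-identityʳ _))) (⊆ᵇ⇒∣∣≤ A S A⊆S))
    by-head false true (suc m′) A⊆V′ = begin
        count false true false (suc m′) + count false true true (suc m′)
      ≡⟨ cong₂ _+_ (reduces false true false (suc m′) (suc m′) A⊆V′ (λ b → b) (λ b → b))
                   (reduces false true true (suc m′) m′ A⊆V′
                      (λ { (A⊆S , S⊆V , eq) → A⊆S , S⊆V , suc-injective (trans eq (+-suc _ m′)) })
                      (λ { (A⊆S , S⊆V , eq) → A⊆S , S⊆V , trans (cong suc eq) (sym (+-suc _ m′)) })) ⟩
        gap A V C suc m′ + gap A V C m′
      ≡⟨ +-comm (gap A V C suc m′) _ ⟩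
        gap A V C m′ + gap A V C suc m′
      ≡⟨ nCk+nC[k+1]≡[n+1]C[k+1] (gap A V) m′ ⟩
        suc (gap A V) C suc m′ ∎
      where open ≡-Reasoning
    by-head true true m A⊆V′ =
      cong₂ _+_ (impossible true true false m (λ { (() , _) }))
                (reduces true true true m m A⊆V′ (λ { (A⊆S , S⊆V , eq) → A⊆S , S⊆V , suc-injective eq })
                                                (λ { (A⊆S , S⊆V , eq) → A⊆S , S⊆V , cong suc eq }))
    by-head true false m ()

-- The factor  L! / (k!^(L/k) (L/k)!)  counts partitions of an L-set into blocks of size k.
-- For k = K = suc k′ and L = K·q it equals ways k′ q = ∏_{j<q} C(K·j + k′, k′): the block of
-- the least remaining point is chosen q times.
module FactorArithmetic where

  choose-factorials : ∀ a b → ((a + b) C b) * (a ! * b !) ≡ (a + b) !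
  choose-factorials a b = begin
      ((a + b) C b) * (a ! * b !)
    ≡⟨ cong (λ x → ((a + b) C b) * (x ! * b !)) (sym (m+n∸n≡m a b)) ⟩
      ((a + b) C b) * ((a + b ∸ b) ! * b !)
    ≡⟨ cong (((a + b) C b) *_) (*-comm ((a + b ∸ b) !) (b !)) ⟩
      ((a + b) C b) * (b ! * (a + b ∸ b) !)
    ≡⟨ cong (_* (b ! * (a + b ∸ b) !)) (nCk≡n!/k![n-k]! b≤a+b) ⟩
      (a + b) ! / (b ! * (a + b ∸ b) !) * (b ! * (a + b ∸ b) !)
    ≡⟨ m/n*n≡m (k![n∸k]!∣n! b≤a+b) ⟩
      (a + b) ! ∎
    where
    open ≡-Reasoning
    instance _ = b !* (a + b ∸ b) !≢0
    b≤a+b : b ≤ a + b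
    b≤a+b = m≤n+m b a

  ways : ℕ → ℕ → ℕ
  ways k zero = 1
  ways k (suc q) = ((suc k * q + k) C k) * ways k q

  ways-spec : ∀ k q → ways k q * ((suc k !) ^ q * q !) ≡ (suc k * q) !
  ways-spec k zero = cong _! (sym (*-zeroʳ (suc k)))
  ways-spec k (suc q) = begin
      c * ways k q * ((suc k * k !) * p * (suc q * q !))
    ≡⟨ regroup c (ways k q) (k !) p (q !) k q ⟩
      (c * ((ways k q * (p * q !)) * k !)) * (suc k * suc q)
    ≡⟨ cong (λ z → (c * (z * k !)) * (suc k * suc q)) (ways-spec k q) ⟩
      (c * ((suc k * q) ! * k !)) * (suc k * suc q)
    ≡⟨ cong (_* (suc k * suc q)) (choose-factorials (suc k * q) k) ⟩
      M ! * (suc k * suc q)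
    ≡⟨ cong (M ! *_) K[q+1]≡1+M ⟩
      M ! * suc M
    ≡⟨ *-comm (M !) (suc M) ⟩
      suc M !
    ≡⟨ cong _! (sym K[q+1]≡1+M) ⟩
      (suc k * suc q) ! ∎
    where
    open ≡-Reasoning
    M c p : ℕ
    M = suc k * q + k
    c = M C k
    p = (suc k !) ^ q
    K[q+1]≡1+M : suc k * suc q ≡ suc M
    K[q+1]≡1+M = trans (*-suc (suc k) q) (cong suc (+-comm k (suc k * q)))
    regroup : ∀ c w kf p qf k q →
      c * w * ((suc k * kf) * p * (suc q * qf)) ≡ (c * ((w * (p * qf)) * kf)) * (suc k * suc q)
    regroup = solve-∀

  -- Hence the division defining factor is exact.
  factor-ways : ∀ k q → factor (suc k) (suc k * q) ≡ ways k q
  factor-ways k q = begin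
      factor (suc k) (suc k * q)
    ≡⟨ /-congʳ {{denominator≢0 ((suc k * q) / suc k)}} (cong (λ m → (suc k !) ^ m * m !) Kq/K≡q) ⟩
      (suc k * q) ! / den
    ≡⟨ cong (_/ den) (sym (ways-spec k q)) ⟩
      ways k q * den / den
    ≡⟨ m*n/n≡m (ways k q) den ⟩
      ways k q ∎
    where
    open ≡-Reasoning
    den : ℕ
    den = (suc k !) ^ q * q !
    denominator≢0 : ∀ m → NonZero ((suc k !) ^ m * m !)
    denominator≢0 m = m*n≢0 ((suc k !) ^ m) (m !) {{m^n≢0 (suc k !) m {{suc k !≢0}}}} {{m !≢0}}
    instance
      den≢0 : NonZero den
      den≢0 = denominator≢0 q
    Kq/K≡q : (suc k * q) / suc k ≡ q
    Kq/K≡q = trans (cong (_/ suc k) (*-comm (suc k) q)) (m*n/n≡m q (suc k))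

  ways-positive : ∀ k q → 1 ≤ ways k q
  ways-positive k q with ways k q | ways-spec k q
  ... | suc _ | _ = s≤s z≤n
  ... | zero | 0≡[Kq]! = ⊥-elim (<-irrefl 0≡[Kq]! (>-nonZero⁻¹ _ {{(suc k * q) !≢0}}))

  factor-positive : ∀ k L → 1 ≤ k → k ∣ L → 1 ≤ factor k L
  factor-positive (suc k) .(q * suc k) _ (divides-refl q) =
    subst (λ L → 1 ≤ factor (suc k) L) (*-comm (suc k) q) (subst (1 ≤_) (sym (factor-ways k q)) (ways-positive k q))

  factor-zero : ∀ k → factor k 0 ≡ 1
  factor-zero zero = refl
  factor-zero (suc k) = refl

module SubsetFacts {n : ℕ} where

  _∈ᵇ_ : Fin n → Subset n → Set
  i ∈ᵇ p = lookup p i ≡ true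

  _≟ₛ_ : DecidableEquality (Subset n)
  _≟ₛ_ = Data.Vec.Properties.≡-dec _≟ᵇ_

  true≢false : ∀ {b} → b ≡ true → b ≡ false → Data.Empty.⊥
  true≢false refl ()

  ∉⊥ : ∀ {p} j → p ≡ ⊥ → ¬ j ∈ᵇ p
  ∉⊥ j refl j∈⊥ = true≢false j∈⊥ (lookup-replicate j false)

  vec-ext : {A : Set} {v w : Vec A n} → (∀ i → lookup v i ≡ lookup w i) → v ≡ w
  vec-ext {v = v} {w} v≗w = trans (sym (tabulate∘lookup v)) (trans (tabulate-cong v≗w) (tabulate∘lookup w))

  lookup-─ : ∀ {m} (U S : Subset m) i → lookup (U ─ S) i ≡ (if lookup S i then false else lookup U i)
  lookup-─ (u ∷ U) (true ∷ S) zero = refl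
  lookup-─ (u ∷ U) (false ∷ S) zero = refl
  lookup-─ (u ∷ U) (s ∷ S) (suc i) = lookup-─ U S i

  ∈S⇒∉─ : ∀ (U S : Subset n) i → i ∈ᵇ S → lookup (U ─ S) i ≡ false
  ∈S⇒∉─ U S i i∈S = trans (lookup-─ U S i) (cong (λ b → if b then false else lookup U i) i∈S)

  ∉S⇒─≡ : ∀ (U S : Subset n) i → lookup S i ≡ false → lookup (U ─ S) i ≡ lookup U i
  ∉S⇒─≡ U S i i∉S = trans (lookup-─ U S i) (cong (λ b → if b then false else lookup U i) i∉S)

  ∈─⁻ : ∀ (U S : Subset n) i → i ∈ᵇ (U ─ S) → i ∈ᵇ U × lookup S i ≡ false
  ∈─⁻ U S i i∈ with lookup S i in i∈S
  ... | true = ⊥-elim (true≢false i∈ (∈S⇒∉─ U S i i∈S))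
  ... | false = trans (sym (∉S⇒─≡ U S i i∈S)) i∈ , refl

  ∈─⁺ : ∀ (U S : Subset n) i → i ∈ᵇ U → lookup S i ≡ false → i ∈ᵇ (U ─ S)
  ∈─⁺ U S i i∈U i∉S = trans (∉S⇒─≡ U S i i∉S) i∈U

  no-member⇒all-false : ∀ (U : Subset n) → ¬ ∃ (λ i → i ∈ᵇ U) → ∀ i → lookup U i ≡ false
  no-member⇒all-false U ∄i∈U i with lookup U i in i∈U
  ... | true = ⊥-elim (∄i∈U (i , i∈U))
  ... | false = refl

  all-false⇒≡⊥ : ∀ (U : Subset n) → (∀ i → lookup U i ≡ false) → U ≡ ⊥
  all-false⇒≡⊥ U all-false = vec-ext (λ i → trans (all-false i) (sym (lookup-replicate i false)))

  ∣tabulate∣≡length-filter : {A : Set} {P : Pred A 0ℓ} (P? : Decidable P) {m : ℕ} (g : Fin m → A) →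
    ∣ tabulate (λ i → does (P? (g i))) ∣ ≡ length (filter P? (Data.List.tabulate g))
  ∣tabulate∣≡length-filter P? {zero} g = refl
  ∣tabulate∣≡length-filter P? {suc m} g with does (P? (g zero))
  ... | true = cong suc (∣tabulate∣≡length-filter P? (g ∘ suc))
  ... | false = ∣tabulate∣≡length-filter P? (g ∘ suc)

  ∈⇒1≤∣∣ : ∀ {m} (p : Subset m) i → lookup p i ≡ true → 1 ≤ ∣ p ∣
  ∈⇒1≤∣∣ (true ∷ p) zero _ = s≤s z≤n
  ∈⇒1≤∣∣ (true ∷ p) (suc i) _ = s≤s z≤n
  ∈⇒1≤∣∣ (false ∷ p) (suc i) i∈p = ∈⇒1≤∣∣ p i i∈p

  ∣─∣+∣∣ : ∀ {m} (U S : Subset m) → (∀ i → lookup S i ≡ true → lookup U i ≡ true) → ∣ U ─ S ∣ + ∣ S ∣ ≡ ∣ U ∣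
  ∣─∣+∣∣ [] [] _ = refl
  ∣─∣+∣∣ (u ∷ U) (false ∷ S) S⊆U with u
  ... | true = cong suc (∣─∣+∣∣ U S (S⊆U ∘ suc))
  ... | false = ∣─∣+∣∣ U S (S⊆U ∘ suc)
  ∣─∣+∣∣ (u ∷ U) (true ∷ S) S⊆U with u | S⊆U zero refl
  ... | true | _ = trans (+-suc _ _) (cong suc (∣─∣+∣∣ U S (S⊆U ∘ suc)))

  ─-∩ : ∀ {m} (U S L : Subset m) → (U ─ S) ∩ L ≡ (U ∩ L) ─ S
  ─-∩ [] [] [] = refl
  ─-∩ (u ∷ U) (true ∷ S) (x ∷ L) = cong (false ∷_) (─-∩ U S L)
  ─-∩ (u ∷ U) (false ∷ S) (x ∷ L) = cong ((u ∧ x) ∷_) (─-∩ U S L)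

  ─-∩-disjoint : ∀ {m} (U S L : Subset m) → (∀ i → lookup S i ≡ true → lookup L i ≡ false) →
    (U ─ S) ∩ L ≡ U ∩ L
  ─-∩-disjoint [] [] [] _ = refl
  ─-∩-disjoint (u ∷ U) (false ∷ S) (x ∷ L) disj = cong ((u ∧ x) ∷_) (─-∩-disjoint U S L (disj ∘ suc))
  ─-∩-disjoint (u ∷ U) (true ∷ S) (x ∷ L) disj with x | disj zero refl
  ... | false | _ = cong₂ _∷_ (sym (Data.Bool.Properties.∧-zeroʳ u)) (─-∩-disjoint U S L (disj ∘ suc))

-- Partial partitions: partitions of a subset U ⊆ Fin n whose blocks have the sizes
-- prescribed by l, represented by the map i ↦ block of i (empty for i ∉ U).
module PartialPartitions {n : ℕ} (l : Vec ℕ n) where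
  open SubsetFacts {n}
  open Enumeration
  open ListCounting
  open SubsetCounting
  open FactorArithmetic

  Blocks : Set
  Blocks = Vec (Subset n) n

  record PartitionOf (U : Subset n) (B : Blocks) : Set where
    field
      own-block     : ∀ i → i ∈ᵇ U → i ∈ᵇ lookup B i
      same-block    : ∀ i j → j ∈ᵇ lookup B i → lookup B j ≡ lookup B i
      blocks-in-U   : ∀ i j → j ∈ᵇ lookup B i → j ∈ᵇ U
      empty-outside : ∀ i → lookup U i ≡ false → lookup B i ≡ ⊥
      block-sizes   : ∀ i → i ∈ᵇ U → ∣ lookup B i ∣ ≡ lookup l i
  open PartitionOf

  partitionOf? : ∀ U → Decidable (PartitionOf U)
  partitionOf? U B = map′
    (λ (p₁ , p₂ , p₃ , p₄ , p₅) → record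
      { own-block = λ i → p₁ i ; same-block = λ i j → p₂ i j ; blocks-in-U = λ i j → p₃ i j
      ; empty-outside = λ i → p₄ i ; block-sizes = λ i → p₅ i })
    (λ P → own-block P , same-block P , blocks-in-U P , empty-outside P , block-sizes P)
    (all? (λ i → (lookup U i ≟ᵇ true) →-dec (lookup (lookup B i) i ≟ᵇ true)) ×-dec
     all? (λ i → all? (λ j → (lookup (lookup B i) j ≟ᵇ true) →-dec (lookup B j ≟ₛ lookup B i))) ×-dec
     all? (λ i → all? (λ j → (lookup (lookup B i) j ≟ᵇ true) →-dec (lookup U j ≟ᵇ true))) ×-dec
     all? (λ i → (lookup U i ≟ᵇ false) →-dec (lookup B i ≟ₛ ⊥)) ×-dec
     all? (λ i → (lookup U i ≟ᵇ true) →-dec (∣ lookup B i ∣ ≟ lookup l i)))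

  partitionsOf : Subset n → List Blocks
  partitionsOf U = filter (partitionOf? U) (allBlocks n)

  partitionsOf-unique : ∀ U → Unique (partitionsOf U)
  partitionsOf-unique U = filter⁺ (partitionOf? U) (allBlocks-unique n)

  ∈-partitionsOf⁺ : ∀ {U B} → PartitionOf U B → B ∈ partitionsOf U
  ∈-partitionsOf⁺ {U} {B} = ∈-filter⁺ (partitionOf? U) (∈-allBlocks B)

  ∈-partitionsOf⁻ : ∀ {U B} → B ∈ partitionsOf U → PartitionOf U B
  ∈-partitionsOf⁻ {U} = proj₂ ∘ ∈-filter⁻ (partitionOf? U) {xs = allBlocks n}

  override : Subset n → Subset n → Blocks → Blocks
  override S X B = tabulate (λ i → if lookup S i then X else lookup B i)

  lookup-override-∈ : ∀ S X B i → i ∈ᵇ S → lookup (override S X B) i ≡ X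
  lookup-override-∈ S X B i i∈S = trans (lookup∘tabulate _ i) (cong (λ b → if b then X else lookup B i) i∈S)

  lookup-override-∉ : ∀ S X B i → lookup S i ≡ false → lookup (override S X B) i ≡ lookup B i
  lookup-override-∉ S X B i i∉S = trans (lookup∘tabulate _ i) (cong (λ b → if b then X else lookup B i) i∉S)

  remove : Subset n → Blocks → Blocks
  remove S = override S ⊥

  insert : Subset n → Blocks → Blocks
  insert S = override S S

  record IsBlock (U : Subset n) (K : ℕ) (S : Subset n) : Set where
    field
      block-in-U  : ∀ i → i ∈ᵇ S → i ∈ᵇ U
      block-level : ∀ i → i ∈ᵇ S → lookup l i ≡ K
      block-size  : ∣ S ∣ ≡ K
  open IsBlock

  module Removal {U : Subset n} {B : Blocks} (P : PartitionOf U B) (u : Fin n) where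
    S : Subset n
    S = lookup B u

    nonempty-block⇒∈U : ∀ i j → j ∈ᵇ lookup B i → i ∈ᵇ U
    nonempty-block⇒∈U i j j∈Bi with lookup U i in i∉U
    ... | true = refl
    ... | false = ⊥-elim (∉⊥ j (empty-outside P i i∉U) j∈Bi)

    block-of-member : ∀ i → i ∈ᵇ S → lookup B i ≡ S
    block-of-member = same-block P u

    disjoint-from-S : ∀ i j → j ∈ᵇ lookup B i → lookup S i ≡ false → lookup S j ≡ false
    disjoint-from-S i j j∈Bi i∉S with lookup S j in j∈S
    ... | false = refl
    ... | true = ⊥-elim (true≢false (subst (i ∈ᵇ_) Bi≡S (own-block P i (nonempty-block⇒∈U i j j∈Bi))) i∉S)
      where
      Bi≡S : lookup B i ≡ S
      Bi≡S = trans (sym (same-block P i j j∈Bi)) (block-of-member j j∈S)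

    remove-partition : PartitionOf (U ─ S) (remove S B)
    remove-partition = record
      { own-block = λ i i∈U─S →
          let (i∈U , i∉S) = ∈─⁻ U S i i∈U─S
          in subst (i ∈ᵇ_) (sym (lookup-override-∉ S ⊥ B i i∉S)) (own-block P i i∈U)
      ; same-block = same
      ; blocks-in-U = inside
      ; empty-outside = outside
      ; block-sizes = λ i i∈U─S →
          let (i∈U , i∉S) = ∈─⁻ U S i i∈U─S
          in trans (cong ∣_∣ (lookup-override-∉ S ⊥ B i i∉S)) (block-sizes P i i∈U)
      }
      where
      same : ∀ i j → j ∈ᵇ lookup (remove S B) i → lookup (remove S B) j ≡ lookup (remove S B) i
      same i j j∈B′i with lookup S i in i∈S
      ... | true = ⊥-elim (∉⊥ j (lookup-override-∈ S ⊥ B i i∈S) j∈B′i)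
      ... | false =
        let j∈Bi = subst (j ∈ᵇ_) (lookup-override-∉ S ⊥ B i i∈S) j∈B′i
        in trans (lookup-override-∉ S ⊥ B j (disjoint-from-S i j j∈Bi i∈S))
                 (trans (same-block P i j j∈Bi) (sym (lookup-override-∉ S ⊥ B i i∈S)))
      inside : ∀ i j → j ∈ᵇ lookup (remove S B) i → j ∈ᵇ (U ─ S)
      inside i j j∈B′i with lookup S i in i∈S
      ... | true = ⊥-elim (∉⊥ j (lookup-override-∈ S ⊥ B i i∈S) j∈B′i)
      ... | false =
        let j∈Bi = subst (j ∈ᵇ_) (lookup-override-∉ S ⊥ B i i∈S) j∈B′i
        in ∈─⁺ U S j (blocks-in-U P i j j∈Bi) (disjoint-from-S i j j∈Bi i∈S)
      outside : ∀ i → lookup (U ─ S) i ≡ false → lookup (remove S B) i ≡ ⊥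
      outside i i∉U─S with lookup S i in i∈S
      ... | true = lookup-override-∈ S ⊥ B i i∈S
      ... | false = trans (lookup-override-∉ S ⊥ B i i∈S) (empty-outside P i (trans (sym (∉S⇒─≡ U S i i∈S)) i∉U─S))

    insert-remove : insert S (remove S B) ≡ B
    insert-remove = vec-ext pointwise
      where
      pointwise : ∀ i → lookup (insert S (remove S B)) i ≡ lookup B i
      pointwise i with lookup S i in i∈S
      ... | true = trans (lookup-override-∈ S S (remove S B) i i∈S) (sym (block-of-member i i∈S))
      ... | false = trans (lookup-override-∉ S S (remove S B) i i∈S) (lookup-override-∉ S ⊥ B i i∈S)

    module _ (u∈U : u ∈ᵇ U) where
      u∈S : u ∈ᵇ S
      u∈S = own-block P u u∈U

      S-is-block : IsBlock U (lookup l u) S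
      S-is-block = record
        { block-in-U = blocks-in-U P u
        ; block-level = λ i i∈S → trans (sym (block-sizes P i (blocks-in-U P u i i∈S)))
                                        (trans (cong ∣_∣ (block-of-member i i∈S)) (block-sizes P u u∈U))
        ; block-size = block-sizes P u u∈U
        }

  module Insertion {U S : Subset n} {K : ℕ} (S-block : IsBlock U K S) {B′ : Blocks}
                   (P′ : PartitionOf (U ─ S) B′) where
    member-∉S : ∀ i j → j ∈ᵇ lookup B′ i → lookup S j ≡ false
    member-∉S i j j∈B′i = proj₂ (∈─⁻ U S j (blocks-in-U P′ i j j∈B′i))

    ∈S⇒∉U─S : ∀ i → i ∈ᵇ S → lookup (U ─ S) i ≡ false
    ∈S⇒∉U─S = ∈S⇒∉─ U S

    insert-partition : PartitionOf U (insert S B′)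
    insert-partition = record
      { own-block = own
      ; same-block = same
      ; blocks-in-U = inside
      ; empty-outside = outside
      ; block-sizes = sizes
      }
      where
      own : ∀ i → i ∈ᵇ U → i ∈ᵇ lookup (insert S B′) i
      own i i∈U with lookup S i in i∈S
      ... | true = subst (i ∈ᵇ_) (sym (lookup-override-∈ S S B′ i i∈S)) i∈S
      ... | false = subst (i ∈ᵇ_) (sym (lookup-override-∉ S S B′ i i∈S)) (own-block P′ i (∈─⁺ U S i i∈U i∈S))
      same : ∀ i j → j ∈ᵇ lookup (insert S B′) i → lookup (insert S B′) j ≡ lookup (insert S B′) i
      same i j j∈Bi with lookup S i in i∈S
      ... | true = trans (lookup-override-∈ S S B′ j (subst (j ∈ᵇ_) (lookup-override-∈ S S B′ i i∈S) j∈Bi))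
                         (sym (lookup-override-∈ S S B′ i i∈S))
      ... | false =
        let j∈B′i = subst (j ∈ᵇ_) (lookup-override-∉ S S B′ i i∈S) j∈Bi
        in trans (lookup-override-∉ S S B′ j (member-∉S i j j∈B′i))
                 (trans (same-block P′ i j j∈B′i) (sym (lookup-override-∉ S S B′ i i∈S)))
      inside : ∀ i j → j ∈ᵇ lookup (insert S B′) i → j ∈ᵇ U
      inside i j j∈Bi with lookup S i in i∈S
      ... | true = block-in-U S-block j (subst (j ∈ᵇ_) (lookup-override-∈ S S B′ i i∈S) j∈Bi)
      ... | false = proj₁ (∈─⁻ U S j (blocks-in-U P′ i j (subst (j ∈ᵇ_) (lookup-override-∉ S S B′ i i∈S) j∈Bi)))
      outside : ∀ i → lookup U i ≡ false → lookup (insert S B′) i ≡ ⊥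
      outside i i∉U with lookup S i in i∈S
      ... | true = ⊥-elim (true≢false (block-in-U S-block i i∈S) i∉U)
      ... | false = trans (lookup-override-∉ S S B′ i i∈S)
                          (empty-outside P′ i (trans (∉S⇒─≡ U S i i∈S) i∉U))
      sizes : ∀ i → i ∈ᵇ U → ∣ lookup (insert S B′) i ∣ ≡ lookup l i
      sizes i i∈U with lookup S i in i∈S
      ... | true = trans (cong ∣_∣ (lookup-override-∈ S S B′ i i∈S)) (trans (block-size S-block) (sym (block-level S-block i i∈S)))
      ... | false = trans (cong ∣_∣ (lookup-override-∉ S S B′ i i∈S)) (block-sizes P′ i (∈─⁺ U S i i∈U i∈S))

    remove-insert : remove S (insert S B′) ≡ B′
    remove-insert = vec-ext pointwise
      where
      pointwise : ∀ i → lookup (remove S (insert S B′)) i ≡ lookup B′ i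
      pointwise i with lookup S i in i∈S
      ... | true = trans (lookup-override-∈ S ⊥ (insert S B′) i i∈S) (sym (empty-outside P′ i (∈S⇒∉U─S i i∈S)))
      ... | false = trans (lookup-override-∉ S ⊥ (insert S B′) i i∈S) (lookup-override-∉ S S B′ i i∈S)

  level : ℕ → Subset n
  level k = tabulate (λ i → does (lookup l i ≟ k))

  count : Subset n → ℕ → ℕ
  count U k = ∣ U ∩ level k ∣

  lookup-∩-level : ∀ U k i → lookup (U ∩ level k) i ≡ lookup U i ∧ does (lookup l i ≟ k)
  lookup-∩-level U k i = trans (lookup-zipWith _∧_ i U (level k)) (cong (lookup U i ∧_) (lookup∘tabulate _ i))

  ∈∩level : ∀ U k i → i ∈ᵇ U → lookup l i ≡ k → i ∈ᵇ (U ∩ level k)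
  ∈∩level U k i i∈U li≡k = trans (lookup-∩-level U k i) (cong₂ _∧_ i∈U (dec-true (lookup l i ≟ k) li≡k))

  ∈∩level⁻ : ∀ U k i → i ∈ᵇ (U ∩ level k) → i ∈ᵇ U × lookup l i ≡ k
  ∈∩level⁻ U k i i∈ with ∧-true {lookup U i} (trans (sym (lookup-∩-level U k i)) i∈)
  ... | i∈U , li≟k = i∈U , does-true (lookup l i ≟ k) li≟k
    where
    does-true : ∀ {A : Set} (a? : Dec A) → does a? ≡ true → A
    does-true (yes a) _ = a

  count-empty : ∀ U → (∀ i → lookup U i ≡ false) → ∀ k → count U k ≡ 0
  count-empty U all-false k =
    trans (cong (λ V → ∣ V ∩ level k ∣) (all-false⇒≡⊥ U all-false))
          (trans (cong ∣_∣ (∩-zeroˡ (level k))) (∣⊥∣≡0 n))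

  module _ {U S : Subset n} {K : ℕ} (S-block : IsBlock U K S) where

    ∣─block∣ : ∣ U ─ S ∣ + K ≡ ∣ U ∣
    ∣─block∣ = subst (λ x → ∣ U ─ S ∣ + x ≡ ∣ U ∣) (block-size S-block) (∣─∣+∣∣ U S (block-in-U S-block))

    count-remove-same : count (U ─ S) K + K ≡ count U K
    count-remove-same = begin
        ∣ (U ─ S) ∩ level K ∣ + K
      ≡⟨ cong₂ _+_ (cong ∣_∣ (─-∩ U S (level K))) (sym (block-size S-block)) ⟩
        ∣ (U ∩ level K) ─ S ∣ + ∣ S ∣
      ≡⟨ ∣─∣+∣∣ (U ∩ level K) S (λ i i∈S → ∈∩level U K i (block-in-U S-block i i∈S) (block-level S-block i i∈S)) ⟩
        ∣ U ∩ level K ∣ ∎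
      where open ≡-Reasoning

    count-remove-other : ∀ j → ¬ j ≡ K → count (U ─ S) j ≡ count U j
    count-remove-other j j≢K = cong ∣_∣ (─-∩-disjoint U S (level j) S∉level-j)
      where
      S∉level-j : ∀ i → i ∈ᵇ S → lookup (level j) i ≡ false
      S∉level-j i i∈S = trans (lookup∘tabulate _ i)
        (dec-false (lookup l i ≟ j) (λ li≡j → j≢K (trans (sym li≡j) (block-level S-block i i∈S))))

    divisible-after-removal : (∀ k → 1 ≤ k → k ∣ count U k) → ∀ k → 1 ≤ k → k ∣ count (U ─ S) k
    divisible-after-removal divisible k 1≤k with k ≟ K
    ... | yes refl = ∣m+n∣m⇒∣n (subst (k ∣_) (trans (sym count-remove-same) (+-comm _ k)) (divisible k 1≤k)) ∣-refl
    ... | no k≢K = subst (k ∣_) (sym (count-remove-other k k≢K)) (divisible k 1≤k)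

    smaller : ∀ {u bound} → u ∈ᵇ S → ∣ U ∣ < suc bound → ∣ U ─ S ∣ < bound
    smaller {u} u∈S (s≤s ∣U∣≤bound) = begin-strict
        ∣ U ─ S ∣
      <⟨ n<n+1 ⟩
        ∣ U ─ S ∣ + 1
      ≤⟨ +-monoʳ-≤ ∣ U ─ S ∣ (subst (1 ≤_) (block-size S-block) (∈⇒1≤∣∣ S u u∈S)) ⟩
        ∣ U ─ S ∣ + K
      ≡⟨ ∣─block∣ ⟩
        ∣ U ∣
      ≤⟨ ∣U∣≤bound ⟩
        _ ∎
      where
      open ≤-Reasoning
      n<n+1 : ∀ {x} → x < x + 1
      n<n+1 {x} = subst (x <_) (+-comm 1 x) (n<1+n x)

  -- Necessity of divisibility: each level of a partially partitioned U is a union of blocks of that size.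
  level-divisible : ∀ bound U B → ∣ U ∣ < bound → PartitionOf U B → ∀ k → k ∣ count U k
  level-divisible (suc bound) U B ∣U∣≤bound P k with any? (λ i → lookup U i ≟ᵇ true)
  ... | no ∄i∈U = subst (k ∣_) (sym (count-empty U (no-member⇒all-false U ∄i∈U) k)) (k ∣0)
  ... | yes (u , u∈U) = add-block-of-u (k ≟ lookup l u)
    where
    open Removal P u
    ih : k ∣ count (U ─ S) k
    ih = level-divisible bound (U ─ S) (remove S B) (smaller (S-is-block u∈U) (u∈S u∈U) ∣U∣≤bound) remove-partition k
    add-block-of-u : Dec (k ≡ lookup l u) → k ∣ count U k
    add-block-of-u (yes refl) = subst (k ∣_) (count-remove-same (S-is-block u∈U)) (∣m∣n⇒∣m+n ih ∣-refl)
    add-block-of-u (no k≢lu) = subst (k ∣_) (count-remove-other (S-is-block u∈U) k k≢lu) ih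

  #partitions : Subset n → ℕ
  #partitions U = length (partitionsOf U)

  formula : Subset n → ℕ
  formula U = product (map (λ k → factor k (count U k)) (image l))

  module EmptyBase (U : Subset n) (U-empty : ∀ i → lookup U i ≡ false) where

    noBlocks : Blocks
    noBlocks = Vec.replicate n ⊥

    noBlocks-partition : PartitionOf U noBlocks
    noBlocks-partition = record
      { own-block = λ i i∈U → ⊥-elim (true≢false i∈U (U-empty i))
      ; same-block = λ i j j∈⊥ → ⊥-elim (∉⊥ j (lookup-replicate i ⊥) j∈⊥)
      ; blocks-in-U = λ i j j∈⊥ → ⊥-elim (∉⊥ j (lookup-replicate i ⊥) j∈⊥)
      ; empty-outside = λ i _ → lookup-replicate i ⊥
      ; block-sizes = λ i i∈U → ⊥-elim (true≢false i∈U (U-empty i))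
      }

    #partitions-empty : #partitions U ≡ 1
    #partitions-empty = length-≡-of-same-members (partitionsOf-unique U) (All.[] ∷ [])
      (λ B B∈ → here (vec-ext (λ i → trans (empty-outside (∈-partitionsOf⁻ B∈) i (U-empty i))
                                             (sym (lookup-replicate i ⊥)))))
      (λ { B (here refl) → ∈-partitionsOf⁺ noBlocks-partition })

    formula-empty : formula U ≡ 1
    formula-empty = trans (product-cong _ (λ _ → 1) (image l)
                            (λ k _ → trans (cong (factor k) (count-empty U U-empty k)) (factor-zero k)))
                          (product-ones (image l))
      where
      product-ones : (ks : List ℕ) → product (map (λ _ → 1) ks) ≡ 1
      product-ones [] = refl
      product-ones (_ ∷ ks) = trans (+-identityʳ _) (product-ones ks)

  BlockThrough : Subset n → Fin n → ℕ → Subset n → Set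
  BlockThrough U u K S = u ∈ᵇ S × IsBlock U K S

  blockThrough? : ∀ U u K → Decidable (BlockThrough U u K)
  blockThrough? U u K S = map′
    (λ (u∈S , S⊆ , ∣S∣≡K) → u∈S , record
      { block-in-U = λ i i∈S → proj₁ (S⊆ i i∈S) ; block-level = λ i i∈S → proj₂ (S⊆ i i∈S) ; block-size = ∣S∣≡K })
    (λ (u∈S , S-block) → u∈S , (λ i i∈S → block-in-U S-block i i∈S , block-level S-block i i∈S) , block-size S-block)
    ((lookup S u ≟ᵇ true) ×-dec
     all? (λ i → (lookup S i ≟ᵇ true) →-dec ((lookup U i ≟ᵇ true) ×-dec (lookup l i ≟ K))) ×-dec
     (∣ S ∣ ≟ K))

  blocksThrough : Subset n → Fin n → ℕ → List (Subset n)
  blocksThrough U u K = filter (blockThrough? U u K) (subsets n)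

  -- A block of size suc k′ through u is u together with k′ further points of level suc k′ in U:
  -- if there are suc c points of that level, there are C(c, k′) such blocks.
  #blocksThrough : ∀ U u k′ c → u ∈ᵇ U → lookup l u ≡ suc k′ → count U (suc k′) ≡ suc c →
    length (blocksThrough U u (suc k′)) ≡ c C k′
  #blocksThrough U u k′ c u∈U lu≡K countK≡1+c = begin
      length (filter (blockThrough? U u K) (subsets n))
    ≡⟨ length-filter-≐ (blockThrough? U u K) (Between? A V k′) (subsets n) to from ⟩
      length (filter (Between? A V k′) (subsets n))
    ≡⟨ count-between n A V k′ A⊆V ⟩
      gap A V C k′
    ≡⟨ cong (_C k′) gap≡c ⟩
      c C k′ ∎
    where
    open ≡-Reasoning
    K : ℕ
    K = suc k′
    A V : Subset n
    A = ⁅ u ⁆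
    V = U ∩ level K
    u∈A : u ∈ᵇ A
    u∈A = []=⇒lookup (x∈⁅x⁆ u)
    ∈A⇒≡u : ∀ i → i ∈ᵇ A → i ≡ u
    ∈A⇒≡u i i∈A = x∈⁅y⁆⇒x≡y u (lookup⇒[]= i A i∈A)
    A⊆V : A ⊆ᵇ V ≡ true
    A⊆V = ⊆⇒⊆ᵇ A V (λ i i∈A → subst (_∈ᵇ V) (sym (∈A⇒≡u i i∈A)) (∈∩level U K u u∈U lu≡K))
    gap≡c : gap A V ≡ c
    gap≡c = suc-injective (trans (cong (_+ gap A V) (sym (∣⁅x⁆∣≡1 u)))
                                 (trans (∣∣+gap A V A⊆V) countK≡1+c))
    to : ∀ {S} → BlockThrough U u K S → Between A V k′ S
    to {S} (u∈S , S-block) =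
      ⊆⇒⊆ᵇ A S (λ i i∈A → subst (_∈ᵇ S) (sym (∈A⇒≡u i i∈A)) u∈S) ,
      ⊆⇒⊆ᵇ S V (λ i i∈S → ∈∩level U K i (block-in-U S-block i i∈S) (block-level S-block i i∈S)) ,
      trans (block-size S-block) (cong (_+ k′) (sym (∣⁅x⁆∣≡1 u)))
    from : ∀ {S} → Between A V k′ S → BlockThrough U u K S
    from {S} (A⊆S , S⊆V , ∣S∣≡∣A∣+k′) = ⊆ᵇ⇒⊆ A S A⊆S u u∈A , record
      { block-in-U = λ i i∈S → proj₁ (∈∩level⁻ U K i (⊆ᵇ⇒⊆ S V S⊆V i i∈S))
      ; block-level = λ i i∈S → proj₂ (∈∩level⁻ U K i (⊆ᵇ⇒⊆ S V S⊆V i i∈S))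
      ; block-size = trans ∣S∣≡∣A∣+k′ (cong (_+ k′) (∣⁅x⁆∣≡1 u))
      }

  partitionsWithBlock : Subset n → Fin n → Subset n → List Blocks
  partitionsWithBlock U u = fibre _≟ₛ_ (λ B → lookup B u) (partitionsOf U)

  -- They correspond, by removing S, to the partial partitions of U ─ S.
  #partitions-with-block : ∀ U u K S → BlockThrough U u K S →
    length (partitionsWithBlock U u S) ≡ #partitions (U ─ S)
  #partitions-with-block U u K S (u∈S , S-block) =
    length-≡-of-bijection (partitionsWithBlock U u S) (partitionsOf (U ─ S))
      (filter⁺ _ (partitionsOf-unique U)) (partitionsOf-unique (U ─ S))
      (remove S) (insert S) remove∈ insert∈ insert-remove′ remove-insert′
    where
    in-fibre : ∀ {B} → B ∈ partitionsWithBlock U u S →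
      PartitionOf U B × lookup B u ≡ S
    in-fibre {B} B∈ with ∈-filter⁻ (λ B → lookup B u ≟ₛ S) {xs = partitionsOf U} B∈
    ... | B∈U , Bu≡S = ∈-partitionsOf⁻ B∈U , Bu≡S
    remove∈ : ∀ B → B ∈ partitionsWithBlock U u S → remove S B ∈ partitionsOf (U ─ S)
    remove∈ B B∈ with in-fibre B∈
    ... | P , refl = ∈-partitionsOf⁺ (Removal.remove-partition P u)
    insert-remove′ : ∀ B → B ∈ partitionsWithBlock U u S → insert S (remove S B) ≡ B
    insert-remove′ B B∈ with in-fibre B∈
    ... | P , refl = Removal.insert-remove P u
    insert∈ : ∀ B′ → B′ ∈ partitionsOf (U ─ S) → insert S B′ ∈ partitionsWithBlock U u S
    insert∈ B′ B′∈ = ∈-filter⁺ (λ B → lookup B u ≟ₛ S)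
      (∈-partitionsOf⁺ (Insertion.insert-partition S-block (∈-partitionsOf⁻ B′∈)))
      (lookup-override-∈ S S B′ u u∈S)
    remove-insert′ : ∀ B′ → B′ ∈ partitionsOf (U ─ S) → remove S (insert S B′) ≡ B′
    remove-insert′ B′ B′∈ = Insertion.remove-insert S-block (∈-partitionsOf⁻ B′∈)

  -- The levels of U after removing one block of level K = suc k′ from a level of size K (q + 1).
  module AfterBlock (U : Subset n) (k′ q : ℕ) where
    K : ℕ
    K = suc k′

    countAfter : ℕ → ℕ
    countAfter j = if does (j ≟ K) then K * q else count U j

    formulaAfter : ℕ
    formulaAfter = product (map (λ j → factor j (countAfter j)) (image l))

    countAfter-K : countAfter K ≡ K * q
    countAfter-K = cong (λ b → if b then K * q else count U K) (dec-true (K ≟ K) refl)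

    countAfter-other : ∀ j → ¬ j ≡ K → countAfter j ≡ count U j
    countAfter-other j j≢K = cong (λ b → if b then K * q else count U j) (dec-false (j ≟ K) j≢K)

    formula-remove : ∀ S → IsBlock U K S → count U K ≡ K * suc q → formula (U ─ S) ≡ formulaAfter
    formula-remove S S-block countK = product-cong _ _ (image l) (λ j _ → cong (factor j) (count-remove j))
      where
      count-remove : ∀ j → count (U ─ S) j ≡ countAfter j
      count-remove j with j ≟ K
      ... | yes refl = trans (+-cancelʳ-≡ K _ _ (trans (count-remove-same S-block)
                               (trans countK (trans (*-suc K q) (+-comm K (K * q)))))) (sym countAfter-K)
      ... | no j≢K = trans (count-remove-other S-block j j≢K) (sym (countAfter-other j j≢K))

    formula-split : K ∈ image l → count U K ≡ K * suc q → formula U ≡ ((K * q + k′) C k′) * formulaAfter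
    formula-split K∈image countK =
      product-update _≟_ (λ j → factor j (count U j)) (λ j → factor j (countAfter j)) ((K * q + k′) C k′)
        K (image l) (deduplicate-! (map (lookup l) (allFin n))) K∈image factor-K
        (λ j j≢K → cong (factor j) (sym (countAfter-other j j≢K)))
      where
      factor-K : factor K (count U K) ≡ ((K * q + k′) C k′) * factor K (countAfter K)
      factor-K = begin
          factor K (count U K)
        ≡⟨ cong (factor K) countK ⟩
          factor K (K * suc q)
        ≡⟨ factor-ways k′ (suc q) ⟩
          ((K * q + k′) C k′) * ways k′ q
        ≡⟨ cong (((K * q + k′) C k′) *_) (sym (trans (cong (factor K) countAfter-K) (factor-ways k′ q))) ⟩
          ((K * q + k′) C k′) * factor K (countAfter K) ∎
        where open ≡-Reasoning

  -- One induction step: classify the partial partitions of U by the block S of u; each class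
  -- is counted by the partial partitions of U ─ S.
  count-step : ∀ U u k′ q → u ∈ᵇ U → lookup l u ≡ suc k′ → count U (suc k′) ≡ suc k′ * suc q →
    (∀ S → BlockThrough U u (suc k′) S → #partitions (U ─ S) ≡ formula (U ─ S)) →
    #partitions U ≡ formula U
  count-step U u k′ q u∈U lu≡K countK ih = begin
      #partitions U
    ≡⟨ length-by-fibres _≟ₛ_ (λ B → lookup B u) (partitionsOf U) (blocksThrough U u K)
                        (filter⁺ _ (subsets-unique n)) block-of-u∈ ⟩
      sum (map (λ S → length (partitionsWithBlock U u S)) (blocksThrough U u K))
    ≡⟨ sum-cong _ (λ _ → formulaAfter) (blocksThrough U u K) each-class ⟩
      sum (map (λ _ → formulaAfter) (blocksThrough U u K))
    ≡⟨ sum-const formulaAfter (blocksThrough U u K) ⟩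
      length (blocksThrough U u K) * formulaAfter
    ≡⟨ cong (_* formulaAfter) (#blocksThrough U u k′ (K * q + k′) u∈U lu≡K countK′) ⟩
      ((K * q + k′) C k′) * formulaAfter
    ≡⟨ sym (formula-split K∈image countK) ⟩
      formula U ∎
    where
    open ≡-Reasoning
    open AfterBlock U k′ q
    countK′ : count U K ≡ suc (K * q + k′)
    countK′ = trans countK (trans (*-suc K q) (cong suc (+-comm k′ (K * q))))
    K∈image : K ∈ image l
    K∈image = subst (_∈ image l) lu≡K (∈-deduplicate⁺ _≟_ (∈-map⁺ (lookup l) (∈-allFin u)))
    block-of-u∈ : ∀ B → B ∈ partitionsOf U → lookup B u ∈ blocksThrough U u K
    block-of-u∈ B B∈ = ∈-filter⁺ (blockThrough? U u K) (∈-subsets _)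
      (u∈S u∈U , subst (λ k → IsBlock U k S) lu≡K (S-is-block u∈U))
      where open Removal (∈-partitionsOf⁻ B∈) u
    each-class : ∀ S → S ∈ blocksThrough U u K →
      length (partitionsWithBlock U u S) ≡ formulaAfter
    each-class S S∈ = trans (#partitions-with-block U u K S S-through)
                            (trans (ih S S-through) (formula-remove S (proj₂ S-through) countK))
      where
      S-through : BlockThrough U u K S
      S-through = proj₂ (∈-filter⁻ (blockThrough? U u K) {xs = subsets n} S∈)

  count-partitions : ∀ bound U → ∣ U ∣ < bound →
    (∀ i → i ∈ᵇ U → 1 ≤ lookup l i) → (∀ k → 1 ≤ k → k ∣ count U k) →
    #partitions U ≡ formula U
  count-partitions (suc bound) U ∣U∣<bound positive divisible with any? (λ i → lookup U i ≟ᵇ true)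
  ... | no ∄i∈U = trans #partitions-empty (sym formula-empty)
    where open EmptyBase U (no-member⇒all-false U ∄i∈U)
  ... | yes (u , u∈U) with lookup l u in lu | positive u u∈U
  ...   | suc k′ | _ with divisible (suc k′) (s≤s z≤n)
  ...     | divides (suc q) countK = count-step U u k′ q u∈U lu (trans countK (*-comm (suc q) (suc k′))) ih
    where
    ih : ∀ S → BlockThrough U u (suc k′) S → #partitions (U ─ S) ≡ formula (U ─ S)
    ih S (u∈S , S-block) = count-partitions bound (U ─ S) (smaller S-block u∈S ∣U∣<bound)
      (λ i i∈U─S → positive i (proj₁ (∈─⁻ U S i i∈U─S)))
      (divisible-after-removal S-block divisible)
  ...     | divides zero count≡0 = ⊥-elim (1+n≰n (≤-trans u-counted (≤-reflexive count≡0)))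
    where
    u-counted : 1 ≤ count U (suc k′)
    u-counted = ∈⇒1≤∣∣ (U ∩ level (suc k′)) u (∈∩level U (suc k′) u u∈U lu)

  ∈⊤ᵇ : ∀ i → i ∈ᵇ ⊤
  ∈⊤ᵇ i = lookup-replicate i true

  partitionOf-⊤ : ∀ B → IsPartition B → (∀ i → blockSize B i ≡ lookup l i) → PartitionOf ⊤ B
  partitionOf-⊤ B (own , same) sizes = record
    { own-block = λ i _ → []=⇒lookup (own i)
    ; same-block = λ i j j∈Bi → same i j (lookup⇒[]= j (lookup B i) j∈Bi)
    ; blocks-in-U = λ _ j _ → ∈⊤ᵇ j
    ; empty-outside = λ i i∉⊤ → ⊥-elim (true≢false (∈⊤ᵇ i) i∉⊤)
    ; block-sizes = λ i _ → sizes i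
    }

  partitionOf-⊤⇒IsPartition : ∀ {B} → PartitionOf ⊤ B → IsPartition B
  partitionOf-⊤⇒IsPartition {B} P =
    (λ i → lookup⇒[]= i (lookup B i) (own-block P i (∈⊤ᵇ i))) ,
    (λ i j j∈Bi → same-block P i j ([]=⇒lookup j∈Bi))

  partitionOf-⊤⇒sizes : ∀ {B} → PartitionOf ⊤ B → ∀ i → blockSize B i ≡ lookup l i
  partitionOf-⊤⇒sizes P i = block-sizes P i (∈⊤ᵇ i)

  count-⊤ : ∀ k → count ⊤ k ≡ lbar l k
  count-⊤ k = trans (cong ∣_∣ (∩-identityˡ (level k))) (∣tabulate∣≡length-filter (λ i → lookup l i ≟ k) (λ i → i))

  formula-⊤ : formula ⊤ ≡ term l
  formula-⊤ = product-cong _ _ (image l) (λ k _ → cong (factor k) (count-⊤ k))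

-- A function to ℕ that never decreases along a permutation is invariant under it,
-- because the permutation preserves its sum.
module PermutationInvariance where
  open import Algebra.Properties.CommutativeMonoid.Sum +-0-commutativeMonoid using (sum-permute)
    renaming (sum to Σ)

  sum-mono : ∀ {m} (f g : Fin m → ℕ) → (∀ i → f i ≤ g i) → Σ f ≤ Σ g
  sum-mono {zero} f g f≤g = z≤n
  sum-mono {suc m} f g f≤g = +-mono-≤ (f≤g zero) (sum-mono (f ∘ suc) (g ∘ suc) (f≤g ∘ suc))

  equal-sums⇒≗ : ∀ {m} (f g : Fin m → ℕ) → (∀ i → f i ≤ g i) → Σ f ≡ Σ g → ∀ i → f i ≡ g i
  equal-sums⇒≗ {suc m} f g f≤g Σf≡Σg = pointwise
    where
    Σf′≤Σg′ : Σ (f ∘ suc) ≤ Σ (g ∘ suc)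
    Σf′≤Σg′ = sum-mono (f ∘ suc) (g ∘ suc) (f≤g ∘ suc)
    f0≡g0 : f zero ≡ g zero
    f0≡g0 = ≤-antisym (f≤g zero) (+-cancelʳ-≤ (Σ (f ∘ suc)) (g zero) (f zero)
              (≤-trans (+-monoʳ-≤ (g zero) Σf′≤Σg′) (≤-reflexive (sym Σf≡Σg))))
    Σf′≡Σg′ : Σ (f ∘ suc) ≡ Σ (g ∘ suc)
    Σf′≡Σg′ = +-cancelˡ-≡ (f zero) _ _ (trans Σf≡Σg (cong (_+ Σ (g ∘ suc)) (sym f0≡g0)))
    pointwise : ∀ i → f i ≡ g i
    pointwise zero = f0≡g0
    pointwise (suc i) = equal-sums⇒≗ (f ∘ suc) (g ∘ suc) (f≤g ∘ suc) Σf′≡Σg′ i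

  nondecreasing⇒invariant : ∀ {m} (π : Permutation′ m) (f : Fin m → ℕ) →
    (∀ i → f i ≤ f (π ⟨$⟩ʳ i)) → ∀ i → f (π ⟨$⟩ʳ i) ≡ f i
  nondecreasing⇒invariant π f f≤f∘π i =
    sym (equal-sums⇒≗ f (f ∘ (π ⟨$⟩ʳ_)) f≤f∘π (sum-permute f π) i)

  invariant⇒cycle-constant : ∀ {m} (π : Permutation′ m) (f : Fin m → ℕ) →
    (∀ i → f (π ⟨$⟩ʳ i) ≡ f i) → ∀ k i → f (iter π k i) ≡ f i
  invariant⇒cycle-constant π f inv zero i = refl
  invariant⇒cycle-constant π f inv (suc k) i = trans (inv (iter π k i)) (invariant⇒cycle-constant π f inv k i)

module PartitionsWithoutDescents (n : ℕ) (α : Permutation′ n) where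
  open SubsetFacts {n}
  open Enumeration using (allBlocks; ∈-allBlocks; allBlocks-unique)
  open ListCounting
  open FactorArithmetic using (factor-positive)
  open PermutationInvariance

  Blocks : Set
  Blocks = Vec (Subset n) n

  sizes : Blocks → Vec ℕ n
  sizes B = tabulate (blockSize B)

  _≟ᵥ_ : DecidableEquality (Vec ℕ n)
  _≟ᵥ_ = Data.Vec.Properties.≡-dec _≟_

  WithoutDescents : Blocks → Set
  WithoutDescents B = IsPartition B × DEmpty α B

  withoutDescents? : Decidable WithoutDescents
  withoutDescents? B =
    (all? (λ i → i ∈? lookup B i) ×-dec
     all? (λ i → all? (λ j → (j ∈? lookup B i) →-dec (lookup B j ≟ₛ lookup B i)))) ×-dec
    all? (λ i → ¬? (blockSize B (α ⟨$⟩ʳ i) <? blockSize B i))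

  partitions : List Blocks
  partitions = filter withoutDescents? (allBlocks n)

  sizeVectors : List (Vec ℕ n)
  sizeVectors = deduplicate _≟ᵥ_ (map sizes partitions)

  lookup-sizes : ∀ B i → lookup (sizes B) i ≡ blockSize B i
  lookup-sizes B = lookup∘tabulate (blockSize B)

  -- D = ∅ means the block size never drops along α; as α preserves the total, it is α-invariant
  -- and hence constant on the cycles of α.
  no-descents⇒cycle-map : ∀ B → DEmpty α B → IsCycleMap α (sizes B)
  no-descents⇒cycle-map B no-descents i j (k , iterᵏi≡j) = begin
      lookup (sizes B) i      ≡⟨ lookup-sizes B i ⟩
      blockSize B i           ≡⟨ sym (invariant⇒cycle-constant α (blockSize B) invariant k i) ⟩
      blockSize B (iter α k i) ≡⟨ cong (blockSize B) iterᵏi≡j ⟩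
      blockSize B j           ≡⟨ sym (lookup-sizes B j) ⟩
      lookup (sizes B) j      ∎
    where
    open ≡-Reasoning
    invariant : ∀ i → blockSize B (α ⟨$⟩ʳ i) ≡ blockSize B i
    invariant = nondecreasing⇒invariant α (blockSize B) (λ i → ≮⇒≥ (no-descents i))

  cycle-map⇒no-descents : ∀ l B → IsCycleMap α l → (∀ i → blockSize B i ≡ lookup l i) → DEmpty α B
  cycle-map⇒no-descents l B cycle-map sizes≡l i descent = <-irrefl αi≡i descent
    where
    αi≡i : blockSize B (α ⟨$⟩ʳ i) ≡ blockSize B i
    αi≡i = trans (sizes≡l _) (trans (sym (cycle-map i (α ⟨$⟩ʳ i) (1 , refl))) (sym (sizes≡l i)))

  sizes-in-underline : ∀ B → WithoutDescents B → InUnderline α (sizes B)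
  sizes-in-underline B ((own , same) , no-descents) =
    no-descents⇒cycle-map B no-descents ,
    (λ i → subst (1 ≤_) (sym (lookup-sizes B i)) (∈⇒1≤∣∣ (lookup B i) i ([]=⇒lookup (own i)))) ,
    (λ k _ → subst (k ∣_) (count-⊤ k) (level-divisible (suc n) ⊤ B (s≤s (∣p∣≤n ⊤)) P k))
    where
    open PartialPartitions (sizes B)
    P : PartitionOf ⊤ B
    P = partitionOf-⊤ B (own , same) (λ i → sym (lookup-sizes B i))

  module ForSizeVector (l : Vec ℕ n) (l-underline : InUnderline α l) where
    open PartialPartitions l

    cycle-map : IsCycleMap α l
    cycle-map = proj₁ l-underline

    #partitions-⊤ : #partitions ⊤ ≡ term l
    #partitions-⊤ = trans
      (count-partitions (suc n) ⊤ (s≤s (∣p∣≤n ⊤)) (λ i _ → proj₁ (proj₂ l-underline) i)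
                        (λ k 1≤k → subst (k ∣_) (sym (count-⊤ k)) (proj₂ (proj₂ l-underline) k 1≤k)))
      formula-⊤

    term-positive : 1 ≤ term l
    term-positive = >-nonZero⁻¹ (term l) {{product≢0 (AllProperties.map⁺ (All.tabulate factor-nonzero))}}
      where
      factor-nonzero : ∀ {k} → k ∈ image l → NonZero (factor k (lbar l k))
      factor-nonzero k∈image with ∈-map⁻ (lookup l) (∈-deduplicate⁻ _≟_ (map (lookup l) (allFin n)) k∈image)
      ... | i , _ , refl = >-nonZero (factor-positive (lookup l i) _ (positive i) (proj₂ (proj₂ l-underline) _ (positive i)))
        where positive = proj₁ (proj₂ l-underline)

    partitionOf⇒withoutDescents : ∀ {B} → PartitionOf ⊤ B → WithoutDescents B
    partitionOf⇒withoutDescents {B} P =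
      partitionOf-⊤⇒IsPartition P , cycle-map⇒no-descents l B cycle-map (partitionOf-⊤⇒sizes P)

    sizes-partitionOf : ∀ {B} → PartitionOf ⊤ B → sizes B ≡ l
    sizes-partitionOf {B} P = vec-ext (λ i → trans (lookup-sizes B i) (partitionOf-⊤⇒sizes P i))

    -- Some partition has size vector l, since there are term l ≥ 1 of them.
    ∈-sizeVectors : l ∈ sizeVectors
    ∈-sizeVectors with filter-nonempty (partitionOf? ⊤) (allBlocks n) (subst (1 ≤_) (sym #partitions-⊤) term-positive)
    ... | B , _ , P = subst (_∈ sizeVectors) (sizes-partitionOf P)
      (∈-deduplicate⁺ _≟ᵥ_ (∈-map⁺ sizes (∈-filter⁺ withoutDescents? (∈-allBlocks B) (partitionOf⇒withoutDescents P))))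

    #withSizes : length (fibre _≟ᵥ_ sizes partitions l) ≡ term l
    #withSizes = trans (length-≡-of-same-members (filter⁺ _ (filter⁺ withoutDescents? (allBlocks-unique n)))
                                                 (partitionsOf-unique ⊤) to from)
                       #partitions-⊤
      where
      to : ∀ B → B ∈ fibre _≟ᵥ_ sizes partitions l → B ∈ partitionsOf ⊤
      to B B∈ with ∈-filter⁻ (λ B → sizes B ≟ᵥ l) {xs = partitions} B∈
      ... | B∈partitions , sizes≡l with ∈-filter⁻ withoutDescents? {xs = allBlocks n} B∈partitions
      ...   | _ , (isPartition , _) = ∈-partitionsOf⁺ (partitionOf-⊤ B isPartition
              (λ i → trans (sym (lookup-sizes B i)) (cong (λ v → lookup v i) sizes≡l)))
      from : ∀ B → B ∈ partitionsOf ⊤ → B ∈ fibre _≟ᵥ_ sizes partitions l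
      from B B∈ = ∈-filter⁺ (λ B → sizes B ≟ᵥ l)
        (∈-filter⁺ withoutDescents? (∈-allBlocks B) (partitionOf⇒withoutDescents P)) (sizes-partitionOf P)
        where P = ∈-partitionsOf⁻ B∈

  partitions-enumerates : Enumerates WithoutDescents partitions
  partitions-enumerates =
    filter⁺ withoutDescents? (allBlocks-unique n) ,
    (λ B B∈ → proj₂ (∈-filter⁻ withoutDescents? {xs = allBlocks n} B∈)) ,
    (λ B wd → ∈-filter⁺ withoutDescents? (∈-allBlocks B) wd)

  sizeVectors-enumerates : Enumerates (InUnderline α) sizeVectors
  sizeVectors-enumerates = deduplicate-!ᵥ (map sizes partitions) , sound , ForSizeVector.∈-sizeVectors
    where
    open import Data.List.Relation.Unary.Unique.DecPropositional.Properties _≟ᵥ_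
      using () renaming (deduplicate-! to deduplicate-!ᵥ)
    sound : ∀ l → l ∈ sizeVectors → InUnderline α l
    sound l l∈ with ∈-map⁻ sizes (∈-deduplicate⁻ _≟ᵥ_ (map sizes partitions) l∈)
    ... | B , B∈ , refl = sizes-in-underline B (proj₂ (∈-filter⁻ withoutDescents? {xs = allBlocks n} B∈))

  #partitions≡Σterm : length partitions ≡ sum (map term sizeVectors)
  #partitions≡Σterm = begin
      length partitions
    ≡⟨ length-by-fibres _≟ᵥ_ sizes partitions sizeVectors (proj₁ sizeVectors-enumerates)
                        (λ B B∈ → ∈-deduplicate⁺ _≟ᵥ_ (∈-map⁺ sizes B∈)) ⟩
      sum (map (λ l → length (fibre _≟ᵥ_ sizes partitions l)) sizeVectors)
    ≡⟨ sum-cong _ term sizeVectors (λ l l∈ → ForSizeVector.#withSizes l (proj₁ (proj₂ sizeVectors-enumerates) l l∈)) ⟩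
      sum (map term sizeVectors) ∎
    where open ≡-Reasoning

mainTheorem10 : (n : ℕ) (α : Permutation′ n) →
    ∃₂ λ (Ps : List (Vec (Subset n) n)) (Ls : List (Vec ℕ n)) →
      Enumerates (λ B → IsPartition B × DEmpty α B) Ps ×
      Enumerates (InUnderline α) Ls ×
      length Ps ≡ sum (map term Ls)
mainTheorem10 n α =
  partitions , sizeVectors , partitions-enumerates , sizeVectors-enumerates , #partitions≡Σterm
  where open PartitionsWithoutDescents n α
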